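{- Let $G$ be a torsion-free additive abelian group containing an element $a\neq 0$, and let $h\geq 2$ be an integer. If $k\geq 3$ is an integer, then $hk\in\mathcal{R}_G(h,k)$.
   Context: For an integer $h\geq 2$ and a subset $A$ of an additive abelian group $G$, the $h$-fold sumset is $hA=\{a_1+\cdots+a_h : a_1,\dots,a_h\in A\}$ (the $a_i$ need not be distinct). For a positive integer $k$, $\mathcal{R}_G(h,k)=\{|hA| : A\subseteq G,\ |A|=k\}$. A group $G$ is torsion-free if for every nonzero $g\in G$ and every positive integer $n$, $ng\neq 0$. -}

module Defs where

open import Level using (Level)
open import Data.Nat using (ℕ; zero; suc)
open import Data.List using (List; []; _∷_; length)
open import Data.List.Relation.Unary.AllPairs using (AllPairs)
open import Data.List.Relation.Unary.Any using (Any)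
open import Data.List.Relation.Unary.All using (All)
open import Data.Vec using (Vec; foldr)
open import Data.Product using (Σ; _×_; ∃)
open import Relation.Nullary using (¬_)
open import Algebra.Bundles using (AbelianGroup)

module _ {c ℓ : Level} (G : AbelianGroup c ℓ) where
  open AbelianGroup G

  mul : ℕ → Carrier → Carrier
  mul zero g = ε
  mul (suc n) g = g ∙ mul n g

  TorsionFree : Set (c Level.⊔ ℓ)
  TorsionFree = ∀ (g : Carrier) → ¬ (g ≈ ε) → ∀ (n : ℕ) → ¬ (mul (suc n) g ≈ ε)

  -- a finite subset of G, given as a duplicate-free list (w.r.t. ≈)
  Distinct : List Carrier → Set (c Level.⊔ ℓ)
  Distinct = AllPairs (λ x y → ¬ (x ≈ y))

  _∈≈_ : Carrier → List Carrier → Set (c Level.⊔ ℓ)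
  x ∈≈ xs = Any (x ≈_) xs

  vsum : ∀ {h} → Vec Carrier h → Carrier
  vsum = foldr _ _∙_ ε

  InSumset : ℕ → List Carrier → Carrier → Set (c Level.⊔ ℓ)
  InSumset h A x = Σ (Vec Carrier h) λ v → Data.Vec.Relation.Unary.All.All (_∈≈ A) v × (x ≈ vsum v)
    where import Data.Vec.Relation.Unary.All

  SumsetCard : ℕ → List Carrier → ℕ → Set (c Level.⊔ ℓ)
  SumsetCard h A m = Σ (List Carrier) λ S →
    Distinct S × (length S ≡ m)
      × (∀ x → InSumset h A x → x ∈≈ S)
      × All (InSumset h A) S
    where open import Relation.Binary.PropositionalEquality using (_≡_)

  -- m ∈ R_G(h,k) : there is A ⊆ G with |A| = k and |hA| = m
  InR : ℕ → ℕ → ℕ → Set (c Level.⊔ ℓ)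
  InR h k m = Σ (List Carrier) λ A → Distinct A × (length A ≡ k) × SumsetCard h A m
    where open import Relation.Binary.PropositionalEquality using (_≡_)

{-# OPTIONS --safe #-}
-- Take A = {0, 1, …, k − 2, k}·a.  In ℕ the punctured intervals [0, N] ∖ {N − 1} are closed under
-- addition, so h{0, …, k − 2, k} ⊆ [0, hk] ∖ {hk − 1}.  Conversely each m in the latter set is a sum
-- of copies of k, one remainder r ≤ k − 2 and zeros, except that a remainder k − 1 is split as
-- (k − 2) + 1, which needs k ≥ 3.  So |hA| = hk in ℕ, and torsion-freeness makes n ↦ n·a injective,
-- so the count transfers to G.
module Submission where

open import Defs
open import Level using (Level; 0ℓ)
open import Function using (_∘_)
open import Data.Nat using (ℕ; zero; suc; pred; _+_; _*_; _≤_; _<_; _≤?_; s≤s; z<s)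
open import Data.Nat.Properties
open import Data.Product using (Σ; Σ-syntax; ∃₂; ∃-syntax; _×_; _,_)
open import Data.Sum using (_⊎_; inj₁; inj₂)
open import Data.List using (List; _∷_; length; map; downFrom)
open import Data.List.Properties using (length-map; length-downFrom)
open import Data.List.Membership.Propositional using (_∈_; find)
open import Data.List.Membership.Propositional.Properties using (∈-downFrom⁺; ∈-downFrom⁻)
open import Data.List.Relation.Unary.Any as Any using (here; there)
import Data.List.Relation.Unary.Any.Properties as Any
open import Data.List.Relation.Unary.All as All using (All)
import Data.List.Relation.Unary.All.Properties as All
import Data.List.Relation.Unary.AllPairs as AllPairs
import Data.List.Relation.Unary.AllPairs.Properties as AllPairs
open import Data.List.Relation.Unary.Unique.Propositional using (Unique)
open import Data.List.Relation.Unary.Unique.Propositional.Properties using (downFrom⁺)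
open import Data.Vec using (Vec; sum) renaming ([] to []ᵛ; _∷_ to _∷ᵛ_)
import Data.Vec as Vec
import Data.Vec.Relation.Unary.All as VAll
import Data.Vec.Relation.Unary.All.Properties as VAll
open import Relation.Nullary using (¬_; yes; no; contradiction)
open import Relation.Unary using (Pred; _⊆_)
open import Relation.Binary.PropositionalEquality using (_≡_; refl; sym; cong; subst; subst₂)
open import Relation.Binary.Definitions using (tri<; tri≈; tri>)
open import Algebra.Bundles using (AbelianGroup)

private
  variable
    h k m N : ℕ
    L S : List ℕ

Punctured : ℕ → Pred ℕ 0ℓ
Punctured N m = m ≡ N ⊎ suc m < N

punctured : ℕ → List ℕ
punctured N = N ∷ downFrom (pred N)

∈-punctured⁺ : Punctured N m → m ∈ punctured N
∈-punctured⁺ (inj₁ refl) = here refl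
∈-punctured⁺ {suc N} (inj₂ (s≤s m<N)) = there (∈-downFrom⁺ m<N)

∈-punctured⁻ : m ∈ punctured N → Punctured N m
∈-punctured⁻ (here refl) = inj₁ refl
∈-punctured⁻ {N = suc N} (there m∈) = inj₂ (s≤s (∈-downFrom⁻ m∈))

punctured-unique : ∀ N → Unique (punctured N)
punctured-unique N = All.tabulate N≢ AllPairs.∷ downFrom⁺ (pred N)
  where
  N≢ : m ∈ downFrom (pred N) → ¬ N ≡ m
  N≢ m∈ N≡m = <⇒≢ (<-≤-trans (∈-downFrom⁻ m∈) pred[n]≤n) (sym N≡m)

length-punctured : 0 < N → length (punctured N) ≡ N
length-punctured {suc N} _ = cong suc (length-downFrom N)

Punctured-+ : ∀ {M N x y} → Punctured M x → Punctured N y → Punctured (M + N) (x + y)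
Punctured-+ (inj₁ refl) (inj₁ refl) = inj₁ refl
Punctured-+ {N = N} {x = x} {y = y} (inj₁ refl) (inj₂ y+1<N) =
  inj₂ (subst (_< x + N) (+-suc x y) (+-monoʳ-< x y+1<N))
Punctured-+ {N = N} (inj₂ x+1<M) (inj₁ refl) = inj₂ (+-monoˡ-< N x+1<M)
Punctured-+ (inj₂ x+1<M) (inj₂ y+1<N) = inj₂ (+-mono-<-≤ x+1<M (m+n≤o⇒n≤o 2 y+1<N))

Punctured-zero : N ≡ 0 ⊎ 3 ≤ N → Punctured N 0
Punctured-zero (inj₁ refl) = inj₁ refl
Punctured-zero (inj₂ 3≤N) = inj₂ (<⇒≤ 3≤N)

Punctured-pred-split : 3 ≤ suc m → 3 ≤ N
                     → ∃₂ λ x y → Punctured (suc m) x × Punctured N y × m ≡ x + y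
Punctured-pred-split {zero} (s≤s ())
Punctured-pred-split {suc m} _ 3≤N = m , 1 , inj₂ ≤-refl , inj₂ 3≤N , +-comm 1 m

-- The condition on N provides 0 ∈ Punctured N, and 1 ∈ Punctured N for the split k − 1 = (k − 2) + 1.
Punctured-split : 3 ≤ k → N ≡ 0 ⊎ 3 ≤ N → Punctured (k + N) m
                → ∃₂ λ x y → Punctured k x × Punctured N y × m ≡ x + y
Punctured-split _ _ (inj₁ refl) = _ , _ , inj₁ refl , inj₁ refl , refl
Punctured-split {k} {N} {m} 3≤k N≡0∨3≤N (inj₂ m+1<k+N) with k ≤? m
... | yes k≤m with d , refl ← m≤n⇒∃[o]m+o≡n k≤m =
  k , d , inj₁ refl , inj₂ (+-cancelˡ-< k _ _ (subst (_< k + N) (sym (+-suc k d)) m+1<k+N)) , refl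
... | no k≰m with m≤n⇒m<n∨m≡n (≰⇒> k≰m) | N≡0∨3≤N
...   | inj₁ m+1<k | _ = m , 0 , inj₂ m+1<k , Punctured-zero N≡0∨3≤N , sym (+-identityʳ m)
...   | inj₂ refl | inj₂ 3≤N = Punctured-pred-split 3≤k 3≤N
...   | inj₂ refl | inj₁ refl = contradiction m+1<k+N (<-irrefl (sym (+-identityʳ (suc m))))

3≤k⇒h*k≡0∨3≤h*k : 3 ≤ k → ∀ h → h * k ≡ 0 ⊎ 3 ≤ h * k
3≤k⇒h*k≡0∨3≤h*k _ zero = inj₁ refl
3≤k⇒h*k≡0∨3≤h*k {k} 3≤k (suc h) = inj₂ (≤-trans 3≤k (m≤m+n k (h * k)))

SumOf : ℕ → Pred ℕ 0ℓ → Pred ℕ 0ℓ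
SumOf h P m = Σ[ v ∈ Vec ℕ h ] VAll.All P v × m ≡ sum v

SumOf-map : ∀ {P Q} → P ⊆ Q → SumOf h P ⊆ SumOf h Q
SumOf-map P⊆Q (v , pv , m≡) = v , VAll.map P⊆Q pv , m≡

SumOf-Punctured : SumOf h (Punctured k) m → Punctured (h * k) m
SumOf-Punctured (_ , VAll.[] , refl) = inj₁ refl
SumOf-Punctured (_ ∷ᵛ v , px VAll.∷ pv , refl) = Punctured-+ px (SumOf-Punctured (v , pv , refl))

Punctured-SumOf : 3 ≤ k → ∀ h → Punctured (h * k) m → SumOf h (Punctured k) m
Punctured-SumOf _ zero (inj₁ refl) = []ᵛ , VAll.[] , refl
Punctured-SumOf 3≤k (suc h) p
  with x , y , px , py , refl ← Punctured-split 3≤k (3≤k⇒h*k≡0∨3≤h*k 3≤k h) p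
  with v , pv , refl ← Punctured-SumOf 3≤k h py = x ∷ᵛ v , px VAll.∷ pv , refl

module _ {c ℓ : Level} (G : AbelianGroup c ℓ) where
  open AbelianGroup G
    using (Carrier; _≈_; _∙_; ε; monoid; group; ∙-cong; ∙-congˡ)
    renaming (refl to ≈-refl; sym to ≈-sym; trans to ≈-trans)
  open import Algebra.Properties.Group group using (identityʳ-unique)
  import Algebra.Properties.Monoid.Mult monoid as Mult

  mul≡× : ∀ n g → mul G n g ≡ n Mult.× g
  mul≡× zero g = refl
  mul≡× (suc n) g = cong (g ∙_) (mul≡× n g)

  mul-homo-+ : ∀ g m n → mul G (m + n) g ≈ mul G m g ∙ mul G n g
  mul-homo-+ g m n rewrite mul≡× (m + n) g | mul≡× m g | mul≡× n g = Mult.×-homo-+ g m n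

  module _ (a : Carrier) where
    _·a : ℕ → Carrier
    n ·a = mul G n a

    vsum-map-·a : (v : Vec ℕ h) → vsum G (Vec.map _·a v) ≈ sum v ·a
    vsum-map-·a []ᵛ = ≈-refl
    vsum-map-·a (n ∷ᵛ v) = ≈-trans (∙-congˡ (vsum-map-·a v)) (≈-sym (mul-homo-+ a n (sum v)))

    ∈-map-·a : m ∈ L → _∈≈_ G (m ·a) (map _·a L)
    ∈-map-·a m∈L = Any.map⁺ (Any.map (λ { refl → ≈-refl }) m∈L)

    InSumset-map-·a⁺ : SumOf h (_∈ L) m → InSumset G h (map _·a L) (m ·a)
    InSumset-map-·a⁺ (v , pv , refl) =
      Vec.map _·a v , VAll.map⁺ (VAll.map ∈-map-·a pv) , ≈-sym (vsum-map-·a v)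

    vsum-preimage : (u : Vec Carrier h) → VAll.All (λ x → _∈≈_ G x (map _·a L)) u
                  → ∃[ m ] SumOf h (_∈ L) m × vsum G u ≈ m ·a
    vsum-preimage []ᵛ VAll.[] = 0 , ([]ᵛ , VAll.[] , refl) , ≈-refl
    vsum-preimage (x ∷ᵛ u) (px VAll.∷ pu)
      with n , n∈L , x≈ ← find (Any.map⁻ px) | _ , (v , pv , refl) , u≈ ← vsum-preimage u pu =
      n + sum v , (n ∷ᵛ v , n∈L VAll.∷ pv , refl) ,
      ≈-trans (∙-cong x≈ u≈) (≈-sym (mul-homo-+ a n (sum v)))

    InSumset-map-·a⁻ : ∀ {g} → InSumset G h (map _·a L) g → ∃[ m ] SumOf h (_∈ L) m × g ≈ m ·a
    InSumset-map-·a⁻ (u , pu , g≈) with m , s , u≈ ← vsum-preimage u pu = m , s , ≈-trans g≈ u≈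

    module _ (tf : TorsionFree G) (a≉ε : ¬ a ≈ ε) where
      <⇒·a≉ : m < N → ¬ m ·a ≈ N ·a
      <⇒·a≉ {m} m<N m·a≈N·a with d , refl ← m≤n⇒∃[o]m+o≡n m<N =
        tf a a≉ε d (identityʳ-unique (m ·a) (suc d ·a) m·a+[1+d]·a≈m·a)
        where
        open import Relation.Binary.Reasoning.Setoid (AbelianGroup.setoid G)
        m·a+[1+d]·a≈m·a : m ·a ∙ suc d ·a ≈ m ·a
        m·a+[1+d]·a≈m·a = begin
          m ·a ∙ suc d ·a   ≈⟨ mul-homo-+ a m (suc d) ⟨
          (m + suc d) ·a    ≡⟨ cong _·a (+-suc m d) ⟩
          suc (m + d) ·a    ≈⟨ m·a≈N·a ⟨
          m ·a              ∎

      ·a-injective : m ·a ≈ N ·a → m ≡ N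
      ·a-injective {m} {N} m·a≈N·a with <-cmp m N
      ... | tri< m<N _ _ = contradiction m·a≈N·a (<⇒·a≉ m<N)
      ... | tri≈ _ m≡N _ = m≡N
      ... | tri> _ _ N<m = contradiction (≈-sym m·a≈N·a) (<⇒·a≉ N<m)

      Distinct-map-·a : Unique L → Distinct G (map _·a L)
      Distinct-map-·a uL = AllPairs.map⁺ (AllPairs.map (λ m≢n → m≢n ∘ ·a-injective) uL)

      InR-map-·a : ∀ {h L S} → Unique L → Unique S
                 → SumOf h (_∈ L) ⊆ (_∈ S) → All (SumOf h (_∈ L)) S
                 → InR G h (length L) (length S)
      InR-map-·a {h} {L} {S} uL uS sumset⊆S S⊆sumset =
        map _·a L , Distinct-map-·a uL , length-map _·a L ,
        map _·a S , Distinct-map-·a uS , length-map _·a S , sumset⊆map-S ,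
        All.map⁺ (All.map InSumset-map-·a⁺ S⊆sumset)
        where
        sumset⊆map-S : ∀ g → InSumset G h (map _·a L) g → _∈≈_ G g (map _·a S)
        sumset⊆map-S g g∈ with m , m∈ , g≈ ← InSumset-map-·a⁻ g∈ =
          Any.map (≈-trans g≈) (∈-map-·a (sumset⊆S m∈))

corollary3p8 : ∀ {c ℓ : Level} (G : AbelianGroup c ℓ) → TorsionFree G
    → Σ (AbelianGroup.Carrier G) (λ a → ¬ (AbelianGroup._≈_ G a (AbelianGroup.ε G)))
    → (h k : ℕ) → 2 ≤ h → 3 ≤ k → InR G h k (h * k)
corollary3p8 G tf (a , a≉ε) h k 2≤h 3≤k =
  subst₂ (InR G h) (length-punctured 0<k) (length-punctured 0<h*k)
    (InR-map-·a G a tf a≉ε (punctured-unique k) (punctured-unique (h * k)) sumset⊆ ⊆sumset)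
  where
  0<k : 0 < k
  0<k = <-≤-trans z<s 3≤k
  0<h*k : 0 < h * k
  0<h*k = <-≤-trans z<s (*-mono-≤ 2≤h 3≤k)
  sumset⊆ : SumOf h (_∈ punctured k) ⊆ (_∈ punctured (h * k))
  sumset⊆ = ∈-punctured⁺ ∘ SumOf-Punctured ∘ SumOf-map ∈-punctured⁻
  ⊆sumset : All (SumOf h (_∈ punctured k)) (punctured (h * k))
  ⊆sumset = All.tabulate (SumOf-map ∈-punctured⁺ ∘ Punctured-SumOf 3≤k h ∘ ∈-punctured⁻)
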